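{- Let $S$ be a string over $\Sigma$ that terminates with a unique end-marker character $\$$ not occurring elsewhere in $S$, let $w$ be a string, and let $\alpha,\beta\in\Sigma$. Then $(\alpha,\beta)\in\Phi_S(w)$ if and only if all of the following hold: (1) $w$ is an internal branching node of the suffix tree $\mathsf{STree}(S)$; (2) $w$ has a soft Weiner link $W_\alpha(w)$ that points to a leaf $\alpha w t$, where $t$ is a non-empty string and $\beta=t[1]$; (3) $w$ has an out-edge whose label begins with $\beta$ and which leads to a leaf.
   Context: $\mathrm{occ}_S(w)$ is the number of starting positions $i$ with $S[i..i+|w|-1]=w$; a repeat is a $w$ with $\mathrm{occ}_S(w)\ge2$; for a repeat $w$, $\Phi_S(w) = \{(\alpha,\beta)\in\Sigma\times\Sigma \mid \mathrm{occ}_S(\alpha w\beta)=\mathrm{occ}_S(\alpha w)=\mathrm{occ}_S(w\beta)=1\}$ (and $\Phi_S(w)=\emptyset$ if $w$ is not a repeat). The suffix tree $\mathsf{STree}(S)$ is the compacted trie (edges labeled by non-empty strings, internal nodes branching, out-edges of a node start with distinct characters) representing all suffixes of $S$; since $S$ ends with the unique $\$$, its leaves are exactly the suffixes of $S$. A node is identified with the string spelled from the root to it. For a node $v$ and character $a$, the Weiner link $W_a(v)$ is the node $avy$ where $y$ is the shortest string such that $avy$ is a node; it is undefined if $av$ is not a substring of $S$. It is hard if $y$ is empty and soft if $y$ is non-empty. -}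

module Defs where

open import Data.Bool using (Bool; true; false)
open import Data.Nat using (ℕ; zero; suc; _+_; _≤_)
open import Data.List using (List; []; _∷_; _++_; [_]; length)
open import Data.Product using (Σ; ∃; ∃-syntax; _×_; _,_)
open import Data.Sum using (_⊎_)
open import Relation.Nullary using (¬_; yes; no)
open import Relation.Binary.Definitions using (DecidableEquality)
open import Relation.Binary.PropositionalEquality using (_≡_)

module Strings {A : Set} (_≟_ : DecidableEquality A) where

  isPrefix : List A → List A → Bool
  isPrefix [] u = true
  isPrefix (a ∷ w) [] = false
  isPrefix (a ∷ w) (b ∷ u) with a ≟ b
  ... | yes _ = isPrefix w u
  ... | no _  = false

  -- occ S w : number of starting positions i (1 ≤ i ≤ |S| - |w| + 1)
  -- with S[i..i+|w|-1] = w, i.e. number of suffixes of S (including the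
  -- empty one) having w as a prefix.
  occ : List A → List A → ℕ
  occ [] w with isPrefix w []
  ... | true  = 1
  ... | false = 0
  occ (c ∷ S) w with isPrefix w (c ∷ S)
  ... | true  = suc (occ S w)
  ... | false = occ S w

  Repeat : List A → List A → Set
  Repeat S w = 2 ≤ occ S w

  Phi : List A → List A → A → A → Set
  Phi S w α β =
    Repeat S w × occ S (α ∷ w ++ [ β ]) ≡ 1 × occ S (α ∷ w) ≡ 1 × occ S (w ++ [ β ]) ≡ 1

  Substring : List A → List A → Set
  Substring S w = ∃[ u ] ∃[ v ] S ≡ u ++ w ++ v

  -- Nodes of STree(S) (S ends with a unique end-marker):
  --  root = the empty string; leaves = the non-empty suffixes of S;
  --  internal branching nodes = substrings with ≥ 2 distinct right extensions.
  IsLeaf : List A → List A → Set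
  IsLeaf S v = ¬ (v ≡ []) × (∃[ u ] S ≡ u ++ v)

  IsBranching : List A → List A → Set
  IsBranching S v =
    ∃[ a ] ∃[ b ] ¬ (a ≡ b) × Substring S (v ++ [ a ]) × Substring S (v ++ [ b ])

  IsNode : List A → List A → Set
  IsNode S v = (v ≡ []) ⊎ IsLeaf S v ⊎ IsBranching S v

  -- WeinerLink S a v y :  W_a(v) is defined and equals the node a v y,
  -- i.e. a v is a substring, a v y is a node and y is shortest such.
  WeinerLink : List A → A → List A → List A → Set
  WeinerLink S a v y =
    Substring S (a ∷ v) × IsNode S (a ∷ v ++ y) ×
    (∀ y' → IsNode S (a ∷ v ++ y') → length y ≤ length y')

  -- OutEdge S v b y : the node v has an out-edge whose label begins with b,
  -- leading to the child node v b y (label b y); i.e. v b y is a node and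
  -- y is shortest such.
  OutEdge : List A → List A → A → List A → Set
  OutEdge S v b y =
    IsNode S v × IsNode S (v ++ b ∷ y) ×
    (∀ y' → IsNode S (v ++ b ∷ y') → length y ≤ length y')

-- The key fact: a non-empty x occurring at some position with right context v
-- occurs only there iff x v is a leaf and no shorter extension x y is a node.
-- Indeed a shorter node x y would be a second suffix start or a branching node,
-- giving a second occurrence of x; conversely, comparing the contexts of two
-- occurrences of x yields such a shorter node, since the end-marker makes the
-- occurrences of a leaf coincide. Applied to αw (context βv) and to wβ, this turns
-- occ(αw) = occ(wβ) = 1 into the soft Weiner link and the out-edge to leaves, and
-- occ(αwβ) = 1 follows from occ(αw) = 1. Finally w branches because an occurrence
-- of the repeat w other than the one before β is followed by a character ≠ β.
module Submission where

open import Data.Bool using (true; false)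
open import Data.Empty using (⊥-elim)
open import Data.List using (List; []; _∷_; _++_; [_]; length; initLast; _∷ʳ′_)
open import Data.List.Membership.Propositional using (_∈_)
open import Data.List.Properties
  using (∷-injective; ∷-injectiveˡ; ∷-injectiveʳ; ∷ʳ-injectiveʳ; ++-assoc; ++-identityʳ;
         ++-cancelˡ; ++-cancelʳ; ++-conicalˡ; ++-conicalʳ)
open import Data.List.Relation.Unary.Any using (here; there)
open import Data.Nat using (ℕ; suc; pred; _≤_; _<_; s≤s; z≤n)
open import Data.Nat.Properties
  using (≤-pred; ≤-refl; ≤-trans; ≤-reflexive; ≤-antisym; n≤1+n; <⇒≢; <⇒≱; ≰⇒>; <-cmp)
  renaming (_≟_ to _≟ℕ_)
open import Data.Product using (∃-syntax; _×_; _,_; proj₂)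
open import Data.Sum using (inj₁; inj₂)
open import Function.Base using (_∘_)
open import Function.Bundles using (_⇔_; mk⇔)
open import Relation.Binary.Definitions using (DecidableEquality; tri<; tri≈; tri>)
open import Relation.Binary.PropositionalEquality
  using (_≡_; refl; sym; trans; cong; subst)
open import Relation.Nullary using (¬_; yes; no)

open import Defs

++-injective-≡length : ∀ {A : Set} (u₁ u₂ x₁ x₂ : List A) →
                       length u₁ ≡ length u₂ → u₁ ++ x₁ ≡ u₂ ++ x₂ → u₁ ≡ u₂ × x₁ ≡ x₂
++-injective-≡length []       []       x₁ x₂ _   e = refl , e
++-injective-≡length (a ∷ u₁) (b ∷ u₂) x₁ x₂ len e with ∷-injective e
... | refl , e′ with ++-injective-≡length u₁ u₂ x₁ x₂ (cong pred len) e′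
...   | refl , x₁≡x₂ = refl , x₁≡x₂

length-<-++-∷ : ∀ {A : Set} (y : List A) a t → length y < length (y ++ a ∷ t)
length-<-++-∷ []      a t = s≤s z≤n
length-<-++-∷ (_ ∷ y) a t = s≤s (length-<-++-∷ y a t)

∷ʳ-regroup : ∀ {A : Set} (u x : List A) a v → u ++ (x ++ [ a ]) ++ v ≡ u ++ x ++ a ∷ v
∷ʳ-regroup u x a v = cong (u ++_) (++-assoc x [ a ] v)

++-∷ʳ-regroup : ∀ {A : Set} (u x y : List A) a v →
                u ++ ((x ++ y) ++ [ a ]) ++ v ≡ u ++ x ++ y ++ a ∷ v
++-∷ʳ-regroup u x y a v = trans (∷ʳ-regroup u (x ++ y) a v) (cong (u ++_) (++-assoc x y (a ∷ v)))

++-∷≢[] : ∀ {A : Set} (x : List A) a y → ¬ x ++ a ∷ y ≡ []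
++-∷≢[] x a y eq with ++-conicalʳ x (a ∷ y) eq
... | ()

endmarker-last : ∀ {A : Set} {$ : A} (S p z : List A) → ¬ $ ∈ S → S ++ [ $ ] ≡ p ++ $ ∷ z → z ≡ []
endmarker-last []      []      z _    e = sym (∷-injectiveʳ e)
endmarker-last (s ∷ S) []      z $∉ e = ⊥-elim ($∉ (here (sym (∷-injectiveˡ e))))
endmarker-last []      (q ∷ p) z _  e = ⊥-elim (++-∷≢[] p _ z (sym (∷-injectiveʳ e)))
endmarker-last (s ∷ S) (q ∷ p) z $∉ e = endmarker-last S p z ($∉ ∘ there) (∷-injectiveʳ e)

module Occurrences {A : Set} (_≟_ : DecidableEquality A) where
  open Strings _≟_

  isPrefix-sound : ∀ w x → isPrefix w x ≡ true → ∃[ z ] x ≡ w ++ z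
  isPrefix-sound []      x       _ = x , refl
  isPrefix-sound (a ∷ w) []      ()
  isPrefix-sound (a ∷ w) (b ∷ x) e with a ≟ b
  isPrefix-sound (a ∷ w) (b ∷ x) e  | yes refl with isPrefix-sound w x e
  ...                                           | z , x≡wz = z , cong (a ∷_) x≡wz
  isPrefix-sound (a ∷ w) (b ∷ x) () | no _

  isPrefix-++ : ∀ w z → isPrefix w (w ++ z) ≡ true
  isPrefix-++ []      z = refl
  isPrefix-++ (a ∷ w) z with a ≟ a
  ... | yes _  = isPrefix-++ w z
  ... | no a≢a = ⊥-elim (a≢a refl)

  occ-∷-prefix : ∀ c S w → isPrefix w (c ∷ S) ≡ true → occ (c ∷ S) w ≡ suc (occ S w)
  occ-∷-prefix c S w e with isPrefix w (c ∷ S)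
  occ-∷-prefix c S w e  | true = refl
  occ-∷-prefix c S w () | false

  occ-∷-≥ : ∀ c S w → occ S w ≤ occ (c ∷ S) w
  occ-∷-≥ c S w with isPrefix w (c ∷ S)
  ... | true  = n≤1+n _
  ... | false = ≤-refl

  occ-++-≥ : ∀ u S w → occ S w ≤ occ (u ++ S) w
  occ-++-≥ []      S w = ≤-refl
  occ-++-≥ (c ∷ u) S w = ≤-trans (occ-++-≥ u S w) (occ-∷-≥ c (u ++ S) w)

  occ-≥1-prefix : ∀ T w → isPrefix w T ≡ true → 1 ≤ occ T w
  occ-≥1-prefix []      w e with isPrefix w []
  occ-≥1-prefix []      w e  | true  = s≤s z≤n
  occ-≥1-prefix []      w () | false
  occ-≥1-prefix (c ∷ S) w e with isPrefix w (c ∷ S)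
  occ-≥1-prefix (c ∷ S) w e  | true  = s≤s z≤n
  occ-≥1-prefix (c ∷ S) w () | false

  occurrence⇒occ≥1 : ∀ {T} w u v → T ≡ u ++ w ++ v → 1 ≤ occ T w
  occurrence⇒occ≥1 w u v refl =
    ≤-trans (occ-≥1-prefix (w ++ v) w (isPrefix-++ w v)) (occ-++-≥ u (w ++ v) w)

  occ≥1⇒occurrence : ∀ T w → 1 ≤ occ T w → ∃[ u ] ∃[ v ] T ≡ u ++ w ++ v
  occ≥1⇒occurrence []      w h with isPrefix w [] in prefix
  ... | true with isPrefix-sound w [] prefix
  ...   | z , []≡wz = [] , z , []≡wz
  occ≥1⇒occurrence []      w () | false
  occ≥1⇒occurrence (c ∷ S) w h with isPrefix w (c ∷ S) in prefix
  ... | true with isPrefix-sound w (c ∷ S) prefix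
  ...   | z , T≡wz = [] , z , T≡wz
  occ≥1⇒occurrence (c ∷ S) w h | false with occ≥1⇒occurrence S w h
  ...   | u , v , S≡uwv = c ∷ u , v , cong (c ∷_) S≡uwv

  occurrences⇒occ≥2 : ∀ {T} w u₁ v₁ u₂ v₂ → T ≡ u₁ ++ w ++ v₁ → T ≡ u₂ ++ w ++ v₂ →
                      length u₁ < length u₂ → 2 ≤ occ T w
  occurrences⇒occ≥2 w [] v₁ (d ∷ u₂) v₂ e₁ refl _ =
    subst (2 ≤_) (sym (occ-∷-prefix d (u₂ ++ w ++ v₂) w w-at-start))
      (s≤s (occurrence⇒occ≥1 w u₂ v₂ refl))
    where
    w-at-start : isPrefix w (d ∷ u₂ ++ w ++ v₂) ≡ true
    w-at-start = subst (λ X → isPrefix w X ≡ true) (sym e₁) (isPrefix-++ w v₁)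
  occurrences⇒occ≥2 w (c ∷ u₁) v₁ (d ∷ u₂) v₂ refl e₂ (s≤s lt) =
    ≤-trans (occurrences⇒occ≥2 w u₁ v₁ u₂ v₂ refl (∷-injectiveʳ e₂) lt) (occ-∷-≥ c _ w)

  distinct-occurrences⇒occ≥2 : ∀ {T} w u₁ v₁ u₂ v₂ → T ≡ u₁ ++ w ++ v₁ → T ≡ u₂ ++ w ++ v₂ →
                               ¬ length u₁ ≡ length u₂ → 2 ≤ occ T w
  distinct-occurrences⇒occ≥2 w u₁ v₁ u₂ v₂ e₁ e₂ distinct with <-cmp (length u₁) (length u₂)
  ... | tri< lt _ _  = occurrences⇒occ≥2 w u₁ v₁ u₂ v₂ e₁ e₂ lt
  ... | tri≈ _ eq _  = ⊥-elim (distinct eq)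
  ... | tri> _ _ gt  = occurrences⇒occ≥2 w u₂ v₂ u₁ v₁ e₂ e₁ gt

  record TwoOccurrences (T w : List A) : Set where
    constructor twoOccurrences
    field
      u₁ v₁ u₂ v₂ : List A
      first       : T ≡ u₁ ++ w ++ v₁
      second      : T ≡ u₂ ++ w ++ v₂
      earlier     : length u₁ < length u₂

  occ≥2⇒occurrences : ∀ T w → 2 ≤ occ T w → TwoOccurrences T w
  occ≥2⇒occurrences []      w h with isPrefix w []
  occ≥2⇒occurrences []      w (s≤s ()) | true
  occ≥2⇒occurrences []      w ()       | false
  occ≥2⇒occurrences (c ∷ S) w h with isPrefix w (c ∷ S) in prefix
  ... | true with isPrefix-sound w (c ∷ S) prefix | occ≥1⇒occurrence S w (≤-pred h)
  ...   | z , T≡wz | u , v , S≡uwv =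
          twoOccurrences [] z (c ∷ u) v T≡wz (cong (c ∷_) S≡uwv) (s≤s z≤n)
  occ≥2⇒occurrences (c ∷ S) w h | false with occ≥2⇒occurrences S w h
  ...   | twoOccurrences u₁ v₁ u₂ v₂ e₁ e₂ lt =
          twoOccurrences (c ∷ u₁) v₁ (c ∷ u₂) v₂ (cong (c ∷_) e₁) (cong (c ∷_) e₂) (s≤s lt)

  OnlyAt : List A → List A → ℕ → Set
  OnlyAt T x n = ∀ u v → T ≡ u ++ x ++ v → length u ≡ n

  occ≡1⇒onlyAt : ∀ {T x} u₀ v₀ → T ≡ u₀ ++ x ++ v₀ → occ T x ≡ 1 → OnlyAt T x (length u₀)
  occ≡1⇒onlyAt {x = x} u₀ v₀ e₀ once u v e with length u ≟ℕ length u₀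
  ... | yes same    = same
  ... | no distinct =
    ⊥-elim (<⇒≱ ≤-refl (subst (2 ≤_) once (distinct-occurrences⇒occ≥2 x u v u₀ v₀ e e₀ distinct)))

  onlyAt⇒occ≡1 : ∀ {T x n} u v → T ≡ u ++ x ++ v → OnlyAt T x n → occ T x ≡ 1
  onlyAt⇒occ≡1 {T} {x} u v e only =
    ≤-antisym (≤-pred (≰⇒> not-twice)) (occurrence⇒occ≥1 x u v e)
    where
    not-twice : ¬ 2 ≤ occ T x
    not-twice h with occ≥2⇒occurrences T x h
    ... | twoOccurrences u₁ v₁ u₂ v₂ e₁ e₂ lt = <⇒≢ lt (trans (only u₁ v₁ e₁) (sym (only u₂ v₂ e₂)))

  onlyAt-++ʳ : ∀ {T x n} z → OnlyAt T x n → OnlyAt T (x ++ z) n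
  onlyAt-++ʳ {x = x} z only u v e = only u (z ++ v) (trans e (cong (u ++_) (++-assoc x z v)))

  onlyAt-context : ∀ {T x v₀ v} u₀ u → OnlyAt T x (length u₀) →
                   T ≡ u₀ ++ x ++ v₀ → T ≡ u ++ x ++ v → v ≡ v₀
  onlyAt-context {x = x} {v₀} {v} u₀ u only e₀ e =
    ++-cancelˡ x v v₀ (proj₂ (++-injective-≡length u u₀ _ _ (only u v e) (trans (sym e) e₀)))

module Nodes {A : Set} (_≟_ : DecidableEquality A) where
  open Strings _≟_
  open Occurrences _≟_

  data PrefixComparison (t v : List A) : Set where
    diverge : ∀ y a b t₂ v₂ → ¬ a ≡ b → t ≡ y ++ a ∷ t₂ → v ≡ y ++ b ∷ v₂ → PrefixComparison t v
    prefixˡ : ∀ v₂ → v ≡ t ++ v₂ → PrefixComparison t v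
    prefixʳ : ∀ a t₂ → t ≡ v ++ a ∷ t₂ → PrefixComparison t v

  comparePrefix : ∀ t v → PrefixComparison t v
  comparePrefix []      v       = prefixˡ v refl
  comparePrefix (a ∷ t) []      = prefixʳ a t refl
  comparePrefix (a ∷ t) (b ∷ v) with a ≟ b
  ... | no a≢b   = diverge [] a b t v a≢b refl refl
  ... | yes refl with comparePrefix t v
  ...   | diverge y a′ b′ t₂ v₂ a′≢b′ p q =
          diverge (a ∷ y) a′ b′ t₂ v₂ a′≢b′ (cong (a ∷_) p) (cong (a ∷_) q)
  ...   | prefixˡ v₂ p    = prefixˡ v₂ (cong (a ∷_) p)
  ...   | prefixʳ a′ t₂ p = prefixʳ a′ t₂ (cong (a ∷_) p)

  MinimalExtension : List A → List A → List A → Set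
  MinimalExtension T x v = ∀ y → IsNode T (x ++ y) → length v ≤ length y

  onlyAt⇒minimal : ∀ {T v₀} x u₀ → ¬ x ≡ [] → T ≡ u₀ ++ x ++ v₀ →
                   OnlyAt T x (length u₀) → MinimalExtension T x v₀
  onlyAt⇒minimal x u₀ x≢[] e₀ only y (inj₁ root) = ⊥-elim (x≢[] (++-conicalˡ x y root))
  onlyAt⇒minimal x u₀ x≢[] e₀ only y (inj₂ (inj₁ (_ , u , e))) =
    ≤-reflexive (cong length (sym (onlyAt-context u₀ u only e₀ e)))
  onlyAt⇒minimal x u₀ x≢[] e₀ only y (inj₂ (inj₂ (a , b , a≢b , (ua , va , ea) , (ub , vb , eb)))) =
    ⊥-elim (a≢b (∷-injectiveˡ (++-cancelˡ y _ _ (trans ya≡v₀ (sym yb≡v₀)))))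
    where
    ya≡v₀ = onlyAt-context u₀ ua only e₀ (trans ea (++-∷ʳ-regroup ua x y a va))
    yb≡v₀ = onlyAt-context u₀ ub only e₀ (trans eb (++-∷ʳ-regroup ub x y b vb))

  branching⇒repeat : ∀ {T} w → IsBranching T w → 2 ≤ occ T w
  branching⇒repeat w (a , b , a≢b , (ua , va , ea) , (ub , vb , eb)) =
    distinct-occurrences⇒occ≥2 w ua (a ∷ va) ub (b ∷ vb) eaʳ ebʳ distinct
    where
    eaʳ = trans ea (∷ʳ-regroup ua w a va)
    ebʳ = trans eb (∷ʳ-regroup ub w b vb)
    distinct : ¬ length ua ≡ length ub
    distinct same = a≢b (∷-injectiveˡ (++-cancelˡ w _ _
                      (proj₂ (++-injective-≡length ua ub _ _ same (trans (sym eaʳ) ebʳ)))))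

  other-context⇒branching : ∀ {T w β v₀ c v} u₀ u →
                            T ≡ u₀ ++ w ++ β ∷ v₀ → OnlyAt T (w ++ [ β ]) (length u₀) →
                            T ≡ u ++ w ++ c ∷ v → ¬ length u ≡ length u₀ → IsBranching T w
  other-context⇒branching {w = w} {β} {v₀} {c} {v} u₀ u e₀ only e elsewhere with c ≟ β
  ... | yes refl = ⊥-elim (elsewhere (only u v (trans e (sym (∷ʳ-regroup u w c v)))))
  ... | no c≢β   = β , c , (c≢β ∘ sym) ,
                   (u₀ , v₀ , trans e₀ (sym (∷ʳ-regroup u₀ w β v₀))) ,
                   (u , v , trans e (sym (∷ʳ-regroup u w c v)))

module EndMarked {A : Set} (_≟_ : DecidableEquality A) (S' : List A) ($ : A) ($∉S' : ¬ $ ∈ S') where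
  open Strings _≟_
  open Occurrences _≟_
  open Nodes _≟_

  T : List A
  T = S' ++ [ $ ]

  suffix-occurs-only-at-end : ∀ X u₀ u {z} → ¬ X ≡ [] →
                              T ≡ u₀ ++ X → T ≡ u ++ X ++ z → z ≡ [] × u ≡ u₀
  suffix-occurs-only-at-end X u₀ u X≢[] e₀ e with initLast X
  ... | [] = ⊥-elim (X≢[] refl)
  suffix-occurs-only-at-end _ u₀ u {z} X≢[] e₀ e | X′ ∷ʳ′ c
    with ∷ʳ-injectiveʳ S' (u₀ ++ X′) (trans e₀ (sym (++-assoc u₀ X′ [ c ])))
  ... | refl with endmarker-last S' (u ++ X′) z $∉S'
                    (trans e (trans (∷ʳ-regroup u X′ $ z) (sym (++-assoc u X′ ($ ∷ z)))))
  ...   | refl = refl , ++-cancelʳ (X′ ++ [ $ ]) u u₀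
                          (trans (sym (trans e (cong (u ++_) (++-identityʳ (X′ ++ [ $ ]))))) e₀)

  minimal⇒onlyAt : ∀ {t} x u₀ → ¬ x ≡ [] → T ≡ u₀ ++ x ++ t →
                   MinimalExtension T x t → OnlyAt T x (length u₀)
  minimal⇒onlyAt {t} x u₀ x≢[] e₀ minimal u v e with comparePrefix t v
  ... | diverge y a b t₂ v₂ a≢b refl refl =
        ⊥-elim (<⇒≱ (length-<-++-∷ y a t₂) (minimal y (inj₂ (inj₂ (a , b , a≢b ,
          (u₀ , t₂ , trans e₀ (sym (++-∷ʳ-regroup u₀ x y a t₂))) ,
          (u  , v₂ , trans e  (sym (++-∷ʳ-regroup u  x y b v₂))))))))
  ... | prefixˡ v₂ refl =
        cong length (proj₂ (suffix-occurs-only-at-end (x ++ t) u₀ u (x≢[] ∘ ++-conicalˡ x t) e₀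
                              (trans e (cong (u ++_) (sym (++-assoc x t v₂))))))
  ... | prefixʳ a t₂ refl =
        ⊥-elim (<⇒≱ (length-<-++-∷ v a t₂)
                    (minimal v (inj₂ (inj₁ (x≢[] ∘ ++-conicalˡ x v , u , e)))))

  occurrence-elsewhere⇒branching : ∀ {w β v₀} u₀ → ¬ w ≡ [] →
                                   T ≡ u₀ ++ w ++ β ∷ v₀ → OnlyAt T (w ++ [ β ]) (length u₀) →
                                   ∀ u v → T ≡ u ++ w ++ v → ¬ length u ≡ length u₀ →
                                   IsBranching T w
  occurrence-elsewhere⇒branching {w} u₀ w≢[] e₀ only u [] e _
    with suffix-occurs-only-at-end w u u₀ w≢[] (trans e (cong (u ++_) (++-identityʳ w))) e₀
  ... | () , _
  occurrence-elsewhere⇒branching u₀ w≢[] e₀ only u (c ∷ v) e distinct =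
    other-context⇒branching u₀ u e₀ only e distinct

  repeat⇒branching : ∀ {w α β v₀} u₀ → 2 ≤ occ T w → T ≡ (u₀ ++ [ α ]) ++ w ++ β ∷ v₀ →
                     OnlyAt T (w ++ [ β ]) (length (u₀ ++ [ α ])) → IsBranching T w
  -- For w = [] the second occurrence is the empty one just before α.
  repeat⇒branching {[]} {α} {β} {v₀} u₀ _ e₀ only =
    other-context⇒branching {w = []} (u₀ ++ [ α ]) u₀ e₀ only
      (trans e₀ (++-assoc u₀ [ α ] (β ∷ v₀))) (<⇒≢ (length-<-++-∷ u₀ α []))
  repeat⇒branching {w@(_ ∷ _)} {α} u₀ repeat e₀ only with occ≥2⇒occurrences T w repeat
  ... | twoOccurrences u v u′ v′ e e′ lt with length u ≟ℕ length (u₀ ++ [ α ])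
  ...   | no distinct = occurrence-elsewhere⇒branching (u₀ ++ [ α ]) (λ ()) e₀ only u v e distinct
  ...   | yes same    = occurrence-elsewhere⇒branching (u₀ ++ [ α ]) (λ ()) e₀ only u′ v′ e′
                          (<⇒≢ lt ∘ trans same ∘ sym)

  SuffixTreeCondition : List A → A → A → Set
  SuffixTreeCondition w α β =
    IsBranching T w
    × (∃[ t ] ¬ (t ≡ []) × WeinerLink T α w t × IsLeaf T (α ∷ w ++ t) × (∃[ t′ ] t ≡ β ∷ t′))
    × (∃[ y ] OutEdge T w β y × IsLeaf T (w ++ β ∷ y))

  Phi⇒condition : ∀ w α β → Phi T w α β → SuffixTreeCondition w α β
  Phi⇒condition w α β (repeat , onceαwβ , onceαw , oncewβ)
    with occ≥1⇒occurrence T (α ∷ w ++ [ β ]) (≤-reflexive (sym onceαwβ))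
  ... | u₀ , v₀ , e =
    branching ,
    (β ∷ v₀ , (λ ()) , ((u₀ , β ∷ v₀ , eαw) , inj₂ (inj₁ leafαwβ) , minimalαw) ,
     leafαwβ , v₀ , refl) ,
    (v₀ , (inj₂ (inj₂ branching) , inj₂ (inj₁ leafwβ) , minimal-edge) , leafwβ)
    where
    eαw : T ≡ u₀ ++ (α ∷ w) ++ β ∷ v₀
    eαw = trans e (∷ʳ-regroup u₀ (α ∷ w) β v₀)
    ewβ : T ≡ (u₀ ++ [ α ]) ++ (w ++ [ β ]) ++ v₀
    ewβ = trans e (sym (++-assoc u₀ [ α ] ((w ++ [ β ]) ++ v₀)))
    ew : T ≡ (u₀ ++ [ α ]) ++ w ++ β ∷ v₀
    ew = trans ewβ (∷ʳ-regroup (u₀ ++ [ α ]) w β v₀)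
    onlyαw = occ≡1⇒onlyAt u₀ (β ∷ v₀) eαw onceαw
    onlywβ = occ≡1⇒onlyAt (u₀ ++ [ α ]) v₀ ewβ oncewβ
    branching = repeat⇒branching u₀ repeat ew onlywβ
    leafαwβ : IsLeaf T (α ∷ w ++ β ∷ v₀)
    leafαwβ = (λ ()) , u₀ , eαw
    leafwβ : IsLeaf T (w ++ β ∷ v₀)
    leafwβ = ++-∷≢[] w β v₀ , u₀ ++ [ α ] , ew
    minimalαw : MinimalExtension T (α ∷ w) (β ∷ v₀)
    minimalαw = onlyAt⇒minimal (α ∷ w) u₀ (λ ()) eαw onlyαw
    minimal-edge : ∀ y → IsNode T (w ++ β ∷ y) → length v₀ ≤ length y
    minimal-edge y node = onlyAt⇒minimal (w ++ [ β ]) (u₀ ++ [ α ]) (++-∷≢[] w β []) ewβ onlywβ y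
                            (subst (IsNode T) (sym (++-assoc w [ β ] y)) node)

  condition⇒Phi : ∀ w α β → SuffixTreeCondition w α β → Phi T w α β
  condition⇒Phi w α β
    (branching , (_ , _ , (_ , _ , minimalαw) , (_ , u₀ , eαw) , t′ , refl) ,
                 (y , (_ , _ , minimal-edge) , (_ , u₁ , ew))) =
    branching⇒repeat w branching ,
    onlyAt⇒occ≡1 u₀ t′ (trans eαw (sym (∷ʳ-regroup u₀ (α ∷ w) β t′))) (onlyAt-++ʳ [ β ] onlyαw) ,
    onlyAt⇒occ≡1 u₀ (β ∷ t′) eαw onlyαw ,
    onlyAt⇒occ≡1 u₁ y ewβ onlywβ
    where
    onlyαw = minimal⇒onlyAt (α ∷ w) u₀ (λ ()) eαw minimalαw
    ewβ : T ≡ u₁ ++ (w ++ [ β ]) ++ y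
    ewβ = trans ew (sym (∷ʳ-regroup u₁ w β y))
    onlywβ = minimal⇒onlyAt (w ++ [ β ]) u₁ (++-∷≢[] w β []) ewβ
               (λ y′ node → minimal-edge y′ (subst (IsNode T) (++-assoc w [ β ] y′) node))

lemma6 : {A : Set} (_≟_ : DecidableEquality A) (S' : List A) ($ : A) →
         ¬ ($ ∈ S') → (w : List A) (α β : A) →
         let open Strings _≟_ in
         Phi (S' ++ [ $ ]) w α β ⇔
           (IsBranching (S' ++ [ $ ]) w
            × (∃[ t ] ¬ (t ≡ []) × WeinerLink (S' ++ [ $ ]) α w t
                 × IsLeaf (S' ++ [ $ ]) (α ∷ w ++ t) × (∃[ t' ] t ≡ β ∷ t'))
            × (∃[ y ] OutEdge (S' ++ [ $ ]) w β y × IsLeaf (S' ++ [ $ ]) (w ++ β ∷ y)))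
lemma6 _≟_ S' $ $∉S' w α β = mk⇔ (Phi⇒condition w α β) (condition⇒Phi w α β)
  where open EndMarked _≟_ S' $ $∉S'
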